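{- Let $n\ge1$, $S\subseteq[n-1]$ and $T=S\cup\{n\}$, and let $A\le B$ be subsets of $[n]$ with $S\le A\le B\le T$ in the type $C_n$ Gale order. Then $P(\Delta[A,B])$ is a face of $P(\Delta[S,T])$.
   Context: Type $C_n$ Gale order on subsets of $[n]$: for $A=\{a_1<\dots<a_j\}$, $B=\{b_1<\dots<b_k\}$, $A\le B$ iff $j\le k$ and $a_{j-i+1}\le b_{k-i+1}$ for all $i\in[j]$. For $S\le T$, $\Delta[S,T]$ is the delta matroid on $[n]$ whose feasible sets are all $R$ with $S\le R\le T$, and $P(\Delta[S,T])=\operatorname{conv}\{e_R: R\text{ feasible}\}\subseteq\mathbb{R}^n$, $e_R=\sum_{i\in R}e_i$. -}

module Defs where

open import Data.Bool using (Bool; true; false; if_then_else_)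
open import Data.Nat using (ℕ; zero; suc) renaming (_≤_ to _≤ℕ_)
open import Data.Integer using (ℤ; 0ℤ; _+_; _≤_)
open import Data.Fin using (Fin)
open import Data.Fin.Subset using (Subset)
open import Data.Vec using (Vec; []; _∷_)
open import Data.List using (List; []; _∷_; _++_; map; reverse)
open import Data.Product using (_×_; Σ)
open import Data.Unit using (⊤)
open import Data.Empty using (⊥)
open import Relation.Binary.PropositionalEquality using (_≡_)
open import Function.Bundles using (_⇔_)

-- Convention: a subset of [n] = {1,…,n} is a 'Subset n' (Vec Bool n);
-- the position with index i : Fin n represents the element i+1.

elemsAsc : ∀ {n} → Subset n → List ℕ
elemsAsc [] = []
elemsAsc (b ∷ p) = (if b then 1 ∷ [] else []) ++ map suc (elemsAsc p)

elemsDesc : ∀ {n} → Subset n → List ℕ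
elemsDesc p = reverse (elemsAsc p)

-- For decreasing lists (a_j,…,a_1) and (b_k,…,b_1):
-- j ≤ k and a_{j-i+1} ≤ b_{k-i+1} for all i ∈ [j].
GaleList : List ℕ → List ℕ → Set
GaleList [] _ = ⊤
GaleList (a ∷ as) [] = ⊥
GaleList (a ∷ as) (b ∷ bs) = (a ≤ℕ b) × GaleList as bs

_≤G_ : ∀ {n} → Subset n → Subset n → Set
A ≤G B = GaleList (elemsDesc A) (elemsDesc B)

Feasible : ∀ {n} → Subset n → Subset n → Subset n → Set
Feasible S T R = (S ≤G R) × (R ≤G T)

dot : ∀ {n} → Vec ℤ n → Subset n → ℤ
dot [] [] = 0ℤ
dot (w ∷ ws) (b ∷ p) = (if b then w else 0ℤ) + dot ws p

-- P(Δ[A,B]) is a face of P(Δ[S,T]): there is a linear functional w and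
-- a constant c such that ⟨w,x⟩ ≤ c on P(Δ[S,T]) (equivalently on its
-- vertices e_R, R feasible for Δ[S,T]) and the vertices of P(Δ[S,T]) on
-- the hyperplane ⟨w,x⟩ = c are exactly the e_R with R feasible for Δ[A,B].
-- (Since both polytopes are convex hulls of 0/1 points, all of which are
-- vertices, this says P(Δ[A,B]) = P(Δ[S,T]) ∩ {⟨w,x⟩ = c}.)
IsFace : ∀ {n} → (A B S T : Subset n) → Set
IsFace {n} A B S T =
  Σ (Vec ℤ n) λ w → Σ ℤ λ c →
    ((R : Subset n) → Feasible S T R → dot w R ≤ c) ×
    ((R : Subset n) → Feasible S T R → ((dot w R ≡ c) ⇔ Feasible A B R))

{-# OPTIONS --safe #-}
module Submission where

-- Read a subset R ⊆ [n] through its suffix counts c_k(R) = |R ∩ {k,…,n}|.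
-- The Gale order becomes the componentwise order on count vectors, and
-- the counts of S ∪ {n} are those of S plus one.  So the feasible sets of
-- Δ[S,T] are the R with c(R) = c(S) + ρ for a 0/1 vector ρ, i.e. the
-- vertices of a unit cube, and those of Δ[A,B] form the interval [α,β] of
-- that cube, which is the face on which Σ_k γ_k ρ_k, γ_k = α_k + β_k - 1,
-- is maximal.  As c(R) is linear in e_R, this functional pulls back to the
-- weights w_i = γ_1 + … + γ_i on [n].

open import Defs
open import Data.Nat using (ℕ; zero; suc; _≤_; _<_; z≤n; s≤s; z<s)
open import Data.Nat.Properties using (≤-antisym; ≤-refl; ≤-trans; n≤1+n; <-irrefl; m≤n⇒m<n∨m≡n)
import Data.Bool as Bool
open import Data.Bool using (Bool; true; false; if_then_else_; _∨_; f≤t; b≤b)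
open import Data.Fin as Fin using (Fin; fromℕ)
open import Data.Fin.Subset using (Subset; _∪_; ⁅_⁆; ∣_∣)
open import Data.Fin.Subset.Properties using (∪-identityʳ)
import Data.Integer.Base as ℤ
import Data.Integer.Properties as ℤₚ
open import Data.Integer.Base using (ℤ; +_; 0ℤ; 1ℤ; -1ℤ; _+_; _*_; +≤+; -≤+)
open import Data.Integer.Tactic.RingSolver using (solve-∀)
open import Algebra.Properties.AbelianGroup ℤₚ.+-0-abelianGroup using (∙-cancelˡ)
open import Algebra.Properties.CommutativeSemigroup ℤₚ.+-commutativeSemigroup
  using (interchange; x∙yz≈yx∙z)
open import Data.List using (List; []; _∷_; _++_; map; reverse; length)
open import Data.List.Properties using (reverse-++; reverse-map; length-map; length-reverse)
open import Data.List.Relation.Unary.All using (All; []; _∷_; universal)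
open import Data.List.Relation.Unary.All.Properties using (++⁺; map⁺)
open import Data.Vec using (Vec; []; _∷_; lookup; zipWith) renaming (map to mapᵥ)
open import Data.Vec.Relation.Binary.Pointwise.Inductive as Pointwise using (Pointwise; []; _∷_)
open import Data.Product using (_×_; _,_; proj₁; proj₂; ∃-syntax)
open import Data.Product.Function.NonDependent.Propositional using (_×-⇔_)
open import Data.Sum using (inj₁; inj₂)
open import Data.Unit using (tt)
open import Data.Empty using (⊥-elim)
open import Function.Bundles using (_⇔_; mk⇔; Equivalence)
import Function.Properties.Equivalence as ⇔
open import Relation.Binary.PropositionalEquality using (_≡_; refl; sym; trans; cong; cong₂; subst; subst₂)
open import Relation.Nullary using (yes; no)

open Equivalence using (to; from)
open Relation.Binary.PropositionalEquality.≡-Reasoning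

private
  variable
    n : ℕ

-- Gale order and suffix counts

counts : Subset n → Vec ℕ n
counts []      = []
counts (b ∷ p) = ∣ b ∷ p ∣ ∷ counts p

sucIf : Bool → ℕ → ℕ
sucIf b x = if b then suc x else x

∣∷∣ : ∀ b (p : Subset n) → ∣ b ∷ p ∣ ≡ sucIf b ∣ p ∣
∣∷∣ true  p = refl
∣∷∣ false p = refl

oneIf : Bool → List ℕ
oneIf b = if b then 1 ∷ [] else []

elemsDesc-∷ : ∀ b (p : Subset n) → elemsDesc (b ∷ p) ≡ map suc (elemsDesc p) ++ oneIf b
elemsDesc-∷ b p = begin
  reverse (oneIf b ++ map suc (elemsAsc p))            ≡⟨ reverse-++ (oneIf b) (map suc (elemsAsc p)) ⟩
  reverse (map suc (elemsAsc p)) ++ reverse (oneIf b)  ≡⟨ cong₂ _++_ (sym (reverse-map suc (elemsAsc p))) (reverse-oneIf b) ⟩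
  map suc (elemsDesc p) ++ oneIf b                     ∎
  where
  reverse-oneIf : ∀ b → reverse (oneIf b) ≡ oneIf b
  reverse-oneIf true  = refl
  reverse-oneIf false = refl

length-elemsAsc : (p : Subset n) → length (elemsAsc p) ≡ ∣ p ∣
length-elemsAsc []          = refl
length-elemsAsc (true ∷ p)  = cong suc (trans (length-map suc (elemsAsc p)) (length-elemsAsc p))
length-elemsAsc (false ∷ p) = trans (length-map suc (elemsAsc p)) (length-elemsAsc p)

length-elemsDesc-∷ : ∀ b (p : Subset n) → length (map suc (elemsDesc p) ++ oneIf b) ≡ ∣ b ∷ p ∣
length-elemsDesc-∷ b p = begin
  length (map suc (elemsDesc p) ++ oneIf b)  ≡⟨ cong length (sym (elemsDesc-∷ b p)) ⟩
  length (elemsDesc (b ∷ p))                 ≡⟨ length-reverse (elemsAsc (b ∷ p)) ⟩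
  length (elemsAsc (b ∷ p))                  ≡⟨ length-elemsAsc (b ∷ p) ⟩
  ∣ b ∷ p ∣                                  ∎

elemsDesc-positive : (p : Subset n) → All (0 <_) (elemsDesc p)
elemsDesc-positive []      = []
elemsDesc-positive (b ∷ p) rewrite elemsDesc-∷ b p =
  ++⁺ (map⁺ (universal (λ _ → z<s) (elemsDesc p))) (oneIf-positive b)
  where
  oneIf-positive : ∀ b → All (0 <_) (oneIf b)
  oneIf-positive true  = z<s ∷ []
  oneIf-positive false = []

GaleList⇒length≤ : ∀ {xs ys} → GaleList xs ys → length xs ≤ length ys
GaleList⇒length≤ {[]}             _       = z≤n
GaleList⇒length≤ {_ ∷ _} {_ ∷ _} (_ , g) = s≤s (GaleList⇒length≤ g)

GaleList-shift⁻ : ∀ b c {xs ys} → All (0 <_) xs →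
                  GaleList (map suc xs ++ oneIf b) (map suc ys ++ oneIf c) → GaleList xs ys
GaleList-shift⁻ b c     {[]}                 _            _             = tt
GaleList-shift⁻ b false {_ ∷ _}  {[]}       _            ()
GaleList-shift⁻ b true  {_ ∷ _}  {[]}       (z<s ∷ _)   (s≤s () , _)
GaleList-shift⁻ b c     {_ ∷ _}  {_ ∷ _}   (_ ∷ xs>0)  (s≤s x≤y , g) = x≤y , GaleList-shift⁻ b c xs>0 g

GaleList-shift⁺ : ∀ b c {xs ys} → GaleList xs ys →
                  length (map suc xs ++ oneIf b) ≤ length (map suc ys ++ oneIf c) →
                  GaleList (map suc xs ++ oneIf b) (map suc ys ++ oneIf c)
GaleList-shift⁺ false c     {[]}                _       _         = tt
GaleList-shift⁺ true  false {[]}     {[]}      _       ()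
GaleList-shift⁺ true  true  {[]}     {[]}      _       _         = s≤s z≤n , tt
GaleList-shift⁺ true  c     {[]}     {_ ∷ _}  _       _         = s≤s z≤n , tt
GaleList-shift⁺ b     c     {_ ∷ _}  {_ ∷ _}  (x≤y , g) (s≤s l) = s≤s x≤y , GaleList-shift⁺ b c g l

≤G⇒counts≤ : (p q : Subset n) → p ≤G q → Pointwise _≤_ (counts p) (counts q)
≤G⇒counts≤ []      []      _   = []
≤G⇒counts≤ (b ∷ p) (c ∷ q) p≤q =
  subst₂ _≤_ (length-elemsDesc-∷ b p) (length-elemsDesc-∷ c q) (GaleList⇒length≤ shifted)
  ∷ ≤G⇒counts≤ p q (GaleList-shift⁻ b c (elemsDesc-positive p) shifted)
  where shifted = subst₂ GaleList (elemsDesc-∷ b p) (elemsDesc-∷ c q) p≤q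

counts≤⇒≤G : (p q : Subset n) → Pointwise _≤_ (counts p) (counts q) → p ≤G q
counts≤⇒≤G []      []      []                = tt
counts≤⇒≤G (b ∷ p) (c ∷ q) (head≤ ∷ tail≤) =
  subst₂ GaleList (sym (elemsDesc-∷ b p)) (sym (elemsDesc-∷ c q))
    (GaleList-shift⁺ b c (counts≤⇒≤G p q tail≤)
      (subst₂ _≤_ (sym (length-elemsDesc-∷ b p)) (sym (length-elemsDesc-∷ c q)) head≤))

≤G-trans : (p q r : Subset n) → p ≤G q → q ≤G r → p ≤G r
≤G-trans p q r p≤q q≤r =
  counts≤⇒≤G p r (Pointwise.trans ≤-trans (≤G⇒counts≤ p q p≤q) (≤G⇒counts≤ q r q≤r))

∣∪⁅⁆∣ : (p : Subset n) (i : Fin n) → lookup p i ≡ false → ∣ p ∪ ⁅ i ⁆ ∣ ≡ suc ∣ p ∣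
∣∪⁅⁆∣ (false ∷ p) Fin.zero    refl = cong (λ q → suc ∣ q ∣) (∪-identityʳ p)
∣∪⁅⁆∣ (true  ∷ p) (Fin.suc i) i∉p  = cong suc (∣∪⁅⁆∣ p i i∉p)
∣∪⁅⁆∣ (false ∷ p) (Fin.suc i) i∉p  = ∣∪⁅⁆∣ p i i∉p

counts-∪-⁅last⁆ : ∀ m (p : Subset (suc m)) → lookup p (fromℕ m) ≡ false →
                  counts (p ∪ ⁅ fromℕ m ⁆) ≡ mapᵥ suc (counts p)
counts-∪-⁅last⁆ zero    (false ∷ []) refl = refl
counts-∪-⁅last⁆ (suc m) (b ∷ p)      n∉p  =
  cong₂ _∷_ (head b) (counts-∪-⁅last⁆ m p n∉p)
  where
  head : ∀ b → ∣ (b ∨ false) ∷ (p ∪ ⁅ fromℕ m ⁆) ∣ ≡ suc ∣ b ∷ p ∣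
  head true  = cong suc (∣∪⁅⁆∣ p (fromℕ m) n∉p)
  head false = ∣∪⁅⁆∣ p (fromℕ m) n∉p

-- Offsets in the unit cube above a count vector

_⊕_ : Vec ℕ n → Subset n → Vec ℕ n
s ⊕ ρ = zipWith (λ x b → sucIf b x) s ρ

between⇒sucIf : ∀ {x r} → x ≤ r → r ≤ suc x → ∃[ b ] r ≡ sucIf b x
between⇒sucIf x≤r r≤1+x with m≤n⇒m<n∨m≡n r≤1+x
... | inj₁ (s≤s r≤x) = false , ≤-antisym r≤x x≤r
... | inj₂ r≡1+x     = true , r≡1+x

sucIf-≤⇔ : ∀ {a b x} → sucIf a x ≤ sucIf b x ⇔ a Bool.≤ b
sucIf-≤⇔ {false} {false}     = mk⇔ (λ _ → b≤b) (λ _ → ≤-refl)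
sucIf-≤⇔ {false} {true}  {x} = mk⇔ (λ _ → f≤t) (λ _ → n≤1+n x)
sucIf-≤⇔ {true}  {false}     = mk⇔ (λ 1+x≤x → ⊥-elim (<-irrefl refl 1+x≤x)) (λ ())
sucIf-≤⇔ {true}  {true}      = mk⇔ (λ _ → b≤b) (λ _ → ≤-refl)

between⇒⊕ : {s r : Vec ℕ n} → Pointwise _≤_ s r → Pointwise _≤_ r (mapᵥ suc s) → ∃[ ρ ] r ≡ s ⊕ ρ
between⇒⊕ []           []             = [] , refl
between⇒⊕ (x≤r ∷ s≤r) (r≤1+x ∷ r≤1+s) with between⇒sucIf x≤r r≤1+x | between⇒⊕ s≤r r≤1+s
... | b , r≡ | ρ , rs≡ = b ∷ ρ , cong₂ _∷_ r≡ rs≡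

⊕-≤⇔ : {s : Vec ℕ n} {α ρ : Subset n} → Pointwise _≤_ (s ⊕ α) (s ⊕ ρ) ⇔ Pointwise Bool._≤_ α ρ
⊕-≤⇔ {s = []}    {[]}    {[]}    = mk⇔ (λ _ → []) (λ _ → [])
⊕-≤⇔ {s = _ ∷ _} {_ ∷ _} {_ ∷ _} = mk⇔
  (λ { (h ∷ t) → to sucIf-≤⇔ h ∷ to ⊕-≤⇔ t })
  (λ { (h ∷ t) → from sucIf-≤⇔ h ∷ from ⊕-≤⇔ t })

-- An interval of the Boolean lattice is a face of the cube

weight : Bool → Bool → ℤ
weight false false = -1ℤ
weight true  true  = 1ℤ
weight _     _     = 0ℤ

cubeWeight : Subset n → Subset n → Vec ℤ n
cubeWeight = zipWith weight

weight-≤ : ∀ {a b} → a Bool.≤ b → ∀ r → (if r then weight a b else 0ℤ) ℤ.≤ (if a then weight a b else 0ℤ)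
weight-≤ (b≤b {false}) false = ℤₚ.≤-refl
weight-≤ (b≤b {false}) true  = -≤+
weight-≤ (b≤b {true})  false = +≤+ z≤n
weight-≤ (b≤b {true})  true  = ℤₚ.≤-refl
weight-≤ f≤t           false = ℤₚ.≤-refl
weight-≤ f≤t           true  = ℤₚ.≤-refl

weight-≡⇔ : ∀ {a b} → a Bool.≤ b → ∀ r →
            ((if r then weight a b else 0ℤ) ≡ (if a then weight a b else 0ℤ)) ⇔ (a Bool.≤ r × r Bool.≤ b)
weight-≡⇔ (b≤b {false}) false = mk⇔ (λ _ → b≤b , b≤b) (λ _ → refl)
weight-≡⇔ (b≤b {false}) true  = mk⇔ (λ ()) (λ { (_ , ()) })
weight-≡⇔ (b≤b {true})  false = mk⇔ (λ ()) (λ { (() , _) })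
weight-≡⇔ (b≤b {true})  true  = mk⇔ (λ _ → b≤b , b≤b) (λ _ → refl)
weight-≡⇔ f≤t           false = mk⇔ (λ _ → b≤b , f≤t) (λ _ → refl)
weight-≡⇔ f≤t           true  = mk⇔ (λ _ → f≤t , b≤b) (λ _ → refl)

+-≤-≡⇒≡×≡ : ∀ {i j k l} → i ℤ.≤ j → k ℤ.≤ l → i + k ≡ j + l → i ≡ j × k ≡ l
+-≤-≡⇒≡×≡ {i} {j} {k} {l} i≤j k≤l eq with i ℤₚ.≟ j
... | yes refl = refl , ∙-cancelˡ i k l eq
... | no i≢j   = ⊥-elim (ℤₚ.<⇒≢ (ℤₚ.+-mono-<-≤ (ℤₚ.≤∧≢⇒< i≤j i≢j) k≤l) eq)

cube-≤ : {α β : Subset n} → Pointwise Bool._≤_ α β → ∀ ρ →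
         dot (cubeWeight α β) ρ ℤ.≤ dot (cubeWeight α β) α
cube-≤ []            []      = ℤₚ.≤-refl
cube-≤ (a≤b ∷ α≤β) (r ∷ ρ) = ℤₚ.+-mono-≤ (weight-≤ a≤b r) (cube-≤ α≤β ρ)

cube-≡⇔ : {α β : Subset n} → Pointwise Bool._≤_ α β → ∀ ρ →
          (dot (cubeWeight α β) ρ ≡ dot (cubeWeight α β) α) ⇔
          (Pointwise Bool._≤_ α ρ × Pointwise Bool._≤_ ρ β)
cube-≡⇔ []            []      = mk⇔ (λ _ → [] , []) (λ _ → refl)
cube-≡⇔ (a≤b ∷ α≤β) (r ∷ ρ) = mk⇔
  (λ eq → let e , e′    = +-≤-≡⇒≡×≡ (weight-≤ a≤b r) (cube-≤ α≤β ρ) eq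
              a≤r , r≤b = to (weight-≡⇔ a≤b r) e
              α≤ρ , ρ≤β = to (cube-≡⇔ α≤β ρ) e′
          in a≤r ∷ α≤ρ , r≤b ∷ ρ≤β)
  (λ { (a≤r ∷ α≤ρ , r≤b ∷ ρ≤β) →
         cong₂ _+_ (from (weight-≡⇔ a≤b r) (a≤r , r≤b)) (from (cube-≡⇔ α≤β ρ) (α≤ρ , ρ≤β)) })

-- Pulling a functional on count vectors back to subsets

infix 7 _⋅_
_⋅_ : Vec ℤ n → Vec ℕ n → ℤ
[]      ⋅ []       = 0ℤ
(g ∷ γ) ⋅ (x ∷ xs) = g * + x + γ ⋅ xs

prefixSums : Vec ℤ n → Vec ℤ n
prefixSums []      = []
prefixSums (g ∷ γ) = g ∷ mapᵥ (_+_ g) (prefixSums γ)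

*-sucIf : ∀ g b x → g * + sucIf b x ≡ g * + x + (if b then g else 0ℤ)
*-sucIf g true  x = begin
  g * (1ℤ + + x)    ≡⟨ ℤₚ.*-distribˡ-+ g 1ℤ (+ x) ⟩
  g * 1ℤ + g * + x  ≡⟨ cong (_+ g * + x) (ℤₚ.*-identityʳ g) ⟩
  g + g * + x       ≡⟨ ℤₚ.+-comm g (g * + x) ⟩
  g * + x + g       ∎
*-sucIf g false x = sym (ℤₚ.+-identityʳ (g * + x))

dot-map-+ : ∀ g (w : Vec ℤ n) R → dot (mapᵥ (_+_ g) w) R ≡ g * + ∣ R ∣ + dot w R
dot-map-+ g []      []          = sym (trans (ℤₚ.+-identityʳ (g * 0ℤ)) (ℤₚ.*-zeroʳ g))
dot-map-+ g (x ∷ w) (true ∷ R)  = begin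
  (g + x) + dot (mapᵥ (_+_ g) w) R   ≡⟨ cong (_+_ (g + x)) (dot-map-+ g w R) ⟩
  (g + x) + (g * + ∣ R ∣ + dot w R)  ≡⟨ regroup g x (+ ∣ R ∣) (dot w R) ⟩
  g * + suc ∣ R ∣ + (x + dot w R)    ∎
  where
  regroup : ∀ g x k d → (g + x) + (g * k + d) ≡ g * (1ℤ + k) + (x + d)
  regroup = solve-∀
dot-map-+ g (x ∷ w) (false ∷ R) = begin
  0ℤ + dot (mapᵥ (_+_ g) w) R   ≡⟨ ℤₚ.+-identityˡ _ ⟩
  dot (mapᵥ (_+_ g) w) R        ≡⟨ dot-map-+ g w R ⟩
  g * + ∣ R ∣ + dot w R         ≡⟨ cong (_+_ (g * + ∣ R ∣)) (sym (ℤₚ.+-identityˡ _)) ⟩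
  g * + ∣ R ∣ + (0ℤ + dot w R)  ∎

dot-prefixSums : (γ : Vec ℤ n) (R : Subset n) → dot (prefixSums γ) R ≡ γ ⋅ counts R
dot-prefixSums []      []      = refl
dot-prefixSums (g ∷ γ) (b ∷ R) = begin
  gᵇ + dot (mapᵥ (_+_ g) (prefixSums γ)) R   ≡⟨ cong (_+_ gᵇ) (dot-map-+ g (prefixSums γ) R) ⟩
  gᵇ + (g * + ∣ R ∣ + dot (prefixSums γ) R)  ≡⟨ cong (λ d → gᵇ + (g * + ∣ R ∣ + d)) (dot-prefixSums γ R) ⟩
  gᵇ + (g * + ∣ R ∣ + γ ⋅ counts R)          ≡⟨ x∙yz≈yx∙z gᵇ (g * + ∣ R ∣) (γ ⋅ counts R) ⟩
  (g * + ∣ R ∣ + gᵇ) + γ ⋅ counts R          ≡⟨ cong (_+ γ ⋅ counts R) (sym (*-sucIf g b ∣ R ∣)) ⟩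
  g * + sucIf b ∣ R ∣ + γ ⋅ counts R         ≡⟨ cong (λ k → g * + k + γ ⋅ counts R) (sym (∣∷∣ b R)) ⟩
  g * + ∣ b ∷ R ∣ + γ ⋅ counts R             ∎
  where gᵇ = if b then g else 0ℤ

⋅-distrib-⊕ : (γ : Vec ℤ n) (s : Vec ℕ n) (ρ : Subset n) → γ ⋅ (s ⊕ ρ) ≡ γ ⋅ s + dot γ ρ
⋅-distrib-⊕ []      []      []      = refl
⋅-distrib-⊕ (g ∷ γ) (x ∷ s) (b ∷ ρ) = begin
  g * + sucIf b x + γ ⋅ (s ⊕ ρ)                          ≡⟨ cong₂ _+_ (*-sucIf g b x) (⋅-distrib-⊕ γ s ρ) ⟩
  (g * + x + (if b then g else 0ℤ)) + (γ ⋅ s + dot γ ρ)  ≡⟨ interchange (g * + x) _ (γ ⋅ s) (dot γ ρ) ⟩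
  (g * + x + γ ⋅ s) + ((if b then g else 0ℤ) + dot γ ρ)  ∎

dot-prefixSums-⊕ : (γ : Vec ℤ n) {s : Vec ℕ n} {ρ : Subset n} {R : Subset n} →
                   counts R ≡ s ⊕ ρ → dot (prefixSums γ) R ≡ γ ⋅ s + dot γ ρ
dot-prefixSums-⊕ γ {s} {ρ} {R} R≡ = begin
  dot (prefixSums γ) R  ≡⟨ dot-prefixSums γ R ⟩
  γ ⋅ counts R          ≡⟨ cong (γ ⋅_) R≡ ⟩
  γ ⋅ (s ⊕ ρ)           ≡⟨ ⋅-distrib-⊕ γ s ρ ⟩
  γ ⋅ s + dot γ ρ       ∎

≤G⇔⊕-≤ : {s : Vec ℕ n} {P Q π κ : Subset n} →
          counts P ≡ s ⊕ π → counts Q ≡ s ⊕ κ → P ≤G Q ⇔ Pointwise Bool._≤_ π κ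
≤G⇔⊕-≤ {P = P} {Q} P≡ Q≡ = mk⇔
  (λ P≤Q → to ⊕-≤⇔ (subst₂ (Pointwise _≤_) P≡ Q≡ (≤G⇒counts≤ P Q P≤Q)))
  (λ π≤κ → counts≤⇒≤G P Q (subst₂ (Pointwise _≤_) (sym P≡) (sym Q≡) (from ⊕-≤⇔ π≤κ)))

offset-face : {s : Vec ℕ n} {A B R α β ρ : Subset n} →
              counts A ≡ s ⊕ α → counts B ≡ s ⊕ β → A ≤G B → counts R ≡ s ⊕ ρ →
              let w = prefixSums (cubeWeight α β) in
              dot w R ℤ.≤ dot w A × ((dot w R ≡ dot w A) ⇔ (A ≤G R × R ≤G B))
offset-face {s = s} {α = α} {β} {ρ} A≡ B≡ A≤B R≡ =
  subst₂ ℤ._≤_ (sym valueR) (sym valueA) (ℤₚ.+-monoʳ-≤ K (cube-≤ α≤β ρ)) ,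
  ⇔.trans (mk⇔ cancel uncancel)
    (⇔.trans (cube-≡⇔ α≤β ρ) (⇔.sym (≤G⇔⊕-≤ A≡ R≡ ×-⇔ ≤G⇔⊕-≤ R≡ B≡)))
  where
  α≤β = to (≤G⇔⊕-≤ A≡ B≡) A≤B
  γ = cubeWeight α β
  K = γ ⋅ s
  valueR = dot-prefixSums-⊕ γ R≡
  valueA = dot-prefixSums-⊕ γ A≡
  cancel = λ eq → ∙-cancelˡ K _ _ (trans (sym valueR) (trans eq valueA))
  uncancel = λ eq → trans valueR (trans (cong (_+_ K) eq) (sym valueA))

feasible⇒offset : ∀ m (S R : Subset (suc m)) → lookup S (fromℕ m) ≡ false →
                  S ≤G R → R ≤G (S ∪ ⁅ fromℕ m ⁆) → ∃[ ρ ] counts R ≡ counts S ⊕ ρ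
feasible⇒offset m S R n∉S S≤R R≤T =
  between⇒⊕ (≤G⇒counts≤ S R S≤R)
    (subst (Pointwise _≤_ (counts R)) (counts-∪-⁅last⁆ m S n∉S) (≤G⇒counts≤ R (S ∪ ⁅ fromℕ m ⁆) R≤T))

proposition5p6 : (m : ℕ) (S A B : Subset (suc m)) →
    lookup S (fromℕ m) ≡ false →
    S ≤G A → A ≤G B → B ≤G (S ∪ ⁅ fromℕ m ⁆) →
    IsFace A B S (S ∪ ⁅ fromℕ m ⁆)
proposition5p6 m S A B n∉S S≤A A≤B B≤T
  with feasible⇒offset m S A n∉S S≤A (≤G-trans A B (S ∪ ⁅ fromℕ m ⁆) A≤B B≤T)
     | feasible⇒offset m S B n∉S (≤G-trans S A B S≤A A≤B) B≤T
... | α , A≡ | β , B≡ = w , dot w A , (λ R fR → proj₁ (face R fR)) , (λ R fR → proj₂ (face R fR))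
  where
  w = prefixSums (cubeWeight α β)
  face : ∀ R → Feasible S (S ∪ ⁅ fromℕ m ⁆) R →
         dot w R ℤ.≤ dot w A × ((dot w R ≡ dot w A) ⇔ Feasible A B R)
  face R (S≤R , R≤T) with feasible⇒offset m S R n∉S S≤R R≤T
  ... | ρ , R≡ = offset-face A≡ B≡ A≤B R≡
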